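{- Let $n \geq 3$, $m \geq 3$, and $G = K_m^n = K_m \square \cdots \square K_m$ ($n$ factors). Then \[ \frac{3m^n}{n(m-1)+3} \leq \gamma^{\mathrm{GID}}(G) \leq m^{n-1}. \]
   Context: $K_m^n$ is the Hamming graph with vertex set $\mathbb{Z}_m^n$, a group under componentwise addition modulo $m$, two vertices adjacent iff they differ in exactly one coordinate. For $C \subseteq V(G)$, $J_C(v) = N[v] \cap C$ with $N[v]$ the closed neighborhood. $C$ is an identifying code if the sets $J_C(v)$, $v \in V(G)$, are all nonempty and pairwise distinct; a group identifying code is an identifying code that is a subgroup of $V(G)$. $\gamma^{\mathrm{GID}}(G)$ is the minimum cardinality of a group identifying code in $G$. -}

module Defs where

open import Data.Nat using (ℕ; zero; suc; _+_; _∸_)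
open import Data.Nat.DivMod using (_mod_)
open import Data.Fin using (Fin; toℕ; _≟_)
open import Data.Vec using (Vec; []; _∷_; replicate)
open import Data.List using (List; [_]; concatMap; map; allFin; length; filter)
open import Data.Bool using (Bool; true; false; if_then_else_; T)
open import Data.Bool.Properties using (T?)
open import Data.Product using (Σ; _×_)
open import Data.Sum using (_⊎_)
open import Relation.Nullary using (¬_; does)
open import Relation.Binary.PropositionalEquality using (_≡_)
open import Function.Bundles using (_⇔_)

Vertex : ℕ → ℕ → Set
Vertex m n = Vec (Fin m) n

addₘ : ∀ {m} → Fin m → Fin m → Fin m
addₘ {suc k} a b = (toℕ a + toℕ b) mod (suc k)

negₘ : ∀ {m} → Fin m → Fin m
negₘ {suc k} a = (suc k ∸ toℕ a) mod (suc k)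

_⊕_ : ∀ {m n} → Vertex m n → Vertex m n → Vertex m n
[] ⊕ [] = []
(x ∷ xs) ⊕ (y ∷ ys) = addₘ x y ∷ (xs ⊕ ys)

⊖_ : ∀ {m n} → Vertex m n → Vertex m n
⊖ [] = []
⊖ (x ∷ xs) = negₘ x ∷ (⊖ xs)

dist : ∀ {m n} → Vertex m n → Vertex m n → ℕ
dist [] [] = 0
dist (x ∷ xs) (y ∷ ys) = (if does (x ≟ y) then 0 else 1) + dist xs ys

Adjacent : ∀ {m n} → Vertex m n → Vertex m n → Set
Adjacent u v = dist u v ≡ 1

_∈N[_] : ∀ {m n} → Vertex m n → Vertex m n → Set
w ∈N[ v ] = (w ≡ v) ⊎ Adjacent v w

Code : ℕ → ℕ → Set
Code m n = Vertex m n → Bool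

_∈J[_,_] : ∀ {m n} → Vertex m n → Code m n → Vertex m n → Set
c ∈J[ C , v ] = (c ∈N[ v ]) × T (C c)

IsIdentifyingCode : ∀ {m n} → Code m n → Set
IsIdentifyingCode {m} {n} C =
  (∀ (v : Vertex m n) → Σ (Vertex m n) (λ c → c ∈J[ C , v ]))
  × (∀ (u v : Vertex m n) → ¬ (u ≡ v) →
       ¬ (∀ (c : Vertex m n) → (c ∈J[ C , u ]) ⇔ (c ∈J[ C , v ])))

IsSubgroup : ∀ {m n} → Code m n → Set
IsSubgroup {m} {n} C =
  (Σ (Vertex m n) λ e → (∀ x → e ⊕ x ≡ x) × T (C e))
  × (∀ (x y : Vertex m n) → T (C x) → T (C y) → T (C (x ⊕ y)))
  × (∀ (x : Vertex m n) → T (C x) → T (C (⊖ x)))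

IsGroupIdentifyingCode : ∀ {m n} → Code m n → Set
IsGroupIdentifyingCode C = IsSubgroup C × IsIdentifyingCode C

allVertices : ∀ m n → List (Vertex m n)
allVertices m zero = [ [] ]
allVertices m (suc n) = concatMap (λ x → map (x ∷_) (allVertices m n)) (allFin m)

card : ∀ {m n} → Code m n → ℕ
card {m} {n} C = length (filter (λ v → T? (C v)) (allVertices m n))

-- Upper bound: the zero-sum code {v : v₁ + ⋯ + vₙ = 0} is a subgroup with m^(n-1) elements.
-- Resetting one coordinate of any v so that its sum vanishes ("balancing" v) yields a codeword
-- in N[v], and two distinct codewords are never adjacent.  Given u ≠ v differing at k₀, pick two
-- further coordinates i, i′ (here n ≥ 3 is used): if u is a codeword, balancing v at i gives a
-- codeword in N[v] but not in N[u]; otherwise one of the balancings of u at i or i′ misses N[v].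
--
-- Lower bound: for a subgroup C and t ∈ C the reflection x ↦ t − x preserves C and distances,
-- so J(t − v) = t − J(v).  If J(v) = {a, b}, then t = a + b swaps a and b, forcing 2v = a + b;
-- then also 2a − b ∈ J(v), and either 2a − b = a, or t = 2a fixes a and b, forcing 2v = 2a;
-- both give a = b.  Hence every |J(v)| is 1 or at least 3.  A codeword forms the whole of J(v)
-- for at most one v, so 3mⁿ ≤ Σᵥ (|J(v)| + 2·[|J(v)| = 1]) ≤ (1 + n(m − 1))·|C| + 2·|C|.

module Submission where

open import Defs
open import Data.Nat using (ℕ; zero; suc; _+_; _*_; _∸_; _^_; _≤_; _≤ᵇ_; _≡ᵇ_; z≤n; s≤s)
open import Data.Nat.Properties
open import Data.Nat.DivMod using (_%_; %-distribˡ-+; m%n%n≡m%n; m<n⇒m%n≡m; n%n≡0; m%n<n)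
open import Data.Fin as Fin using (Fin; toℕ)
open import Data.Fin.Properties using (toℕ-injective; toℕ<n; toℕ-fromℕ<)
open import Data.Vec using ([]; _∷_; replicate; lookup; _[_]≔_)
open import Data.List.Properties using (map-tabulate; length-tabulate)
open import Data.Vec.Properties using (≡-dec; ∷-injective; lookup∘update; lookup∘update′)
open import Data.List as List using (List; []; _∷_; _++_; map; concatMap; length; filter; allFin)
open import Data.Bool using (Bool; true; false; if_then_else_; T; _∧_; not)
open import Data.Bool.Properties using (T?; T-∧)
open import Data.Product using (Σ; ∃-syntax; _×_; _,_; proj₁; proj₂; map₂)
open import Data.Sum using (_⊎_; inj₁; inj₂)
open import Data.Empty using (⊥-elim)
open import Relation.Nullary using (¬_; Dec; yes; no; does)
open import Relation.Nullary.Decidable using (dec-true; dec-false)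
open import Relation.Binary.Definitions using (DecidableEquality)
open import Relation.Binary.PropositionalEquality
  using (_≡_; _≢_; refl; sym; trans; cong; cong₂; subst; isEquivalence; module ≡-Reasoning)
open import Function using (_∘_; id)
open import Function.Bundles using (_⇔_; mk⇔; Equivalence)
open Equivalence using (to; from)
open import Algebra.Structures using (IsAbelianGroup)
open import Algebra.Bundles using (AbelianGroup)
import Algebra.Properties.AbelianGroup as AbelianGroupProperties
import Algebra.Properties.CommutativeSemigroup
open Algebra.Properties.CommutativeSemigroup +-commutativeSemigroup using (interchange)

does-⇔ : ∀ {P Q : Set} (p : Dec P) (q : Dec Q) → P ⇔ Q → does p ≡ does q
does-⇔ (yes _) (yes _) _ = refl
does-⇔ (no _) (no _) _ = refl
does-⇔ (yes p) (no ¬q) P⇔Q = ⊥-elim (¬q (to P⇔Q p))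
does-⇔ (no ¬p) (yes q) P⇔Q = ⊥-elim (¬p (from P⇔Q q))

T-does⇔ : ∀ {P : Set} (p : Dec P) → T (does p) ⇔ P
T-does⇔ (yes p) = mk⇔ (λ _ → p) _
T-does⇔ (no ¬p) = mk⇔ (λ ()) ¬p

module Counting where

  private variable
    A B : Set

  ⟦_⟧ : Bool → ℕ
  ⟦ true ⟧ = 1
  ⟦ false ⟧ = 0

  ∑ : List A → (A → ℕ) → ℕ
  ∑ [] f = 0
  ∑ (x ∷ xs) f = f x + ∑ xs f

  count : List A → (A → Bool) → ℕ
  count xs P = ∑ xs (λ x → ⟦ P x ⟧)

  ⟦∧⟧ : ∀ b c → ⟦ b ∧ c ⟧ ≡ ⟦ b ⟧ * ⟦ c ⟧
  ⟦∧⟧ true true = refl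
  ⟦∧⟧ true false = refl
  ⟦∧⟧ false c = refl

  ∑-cong : (xs : List A) {f g : A → ℕ} → (∀ x → f x ≡ g x) → ∑ xs f ≡ ∑ xs g
  ∑-cong [] f≗g = refl
  ∑-cong (x ∷ xs) f≗g = cong₂ _+_ (f≗g x) (∑-cong xs f≗g)

  ∑-mono-≤ : (xs : List A) {f g : A → ℕ} → (∀ x → f x ≤ g x) → ∑ xs f ≤ ∑ xs g
  ∑-mono-≤ [] f≤g = z≤n
  ∑-mono-≤ (x ∷ xs) f≤g = +-mono-≤ (f≤g x) (∑-mono-≤ xs f≤g)

  ∑-zero : (xs : List A) → ∑ xs (λ _ → 0) ≡ 0
  ∑-zero [] = refl
  ∑-zero (x ∷ xs) = ∑-zero xs

  ∑-distrib-+ : (xs : List A) (f g : A → ℕ) → ∑ xs (λ x → f x + g x) ≡ ∑ xs f + ∑ xs g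
  ∑-distrib-+ [] f g = refl
  ∑-distrib-+ (x ∷ xs) f g =
    trans (cong (f x + g x +_) (∑-distrib-+ xs f g)) (interchange (f x) (g x) (∑ xs f) (∑ xs g))

  ∑-*ˡ : (xs : List A) (c : ℕ) (f : A → ℕ) → ∑ xs (λ x → c * f x) ≡ c * ∑ xs f
  ∑-*ˡ [] c f = sym (*-zeroʳ c)
  ∑-*ˡ (x ∷ xs) c f = trans (cong (c * f x +_) (∑-*ˡ xs c f)) (sym (*-distribˡ-+ c (f x) (∑ xs f)))

  ∑-comm : (xs : List A) (ys : List B) (f : A → B → ℕ) →
           ∑ xs (λ x → ∑ ys (f x)) ≡ ∑ ys (λ y → ∑ xs (λ x → f x y))
  ∑-comm [] ys f = sym (∑-zero ys)
  ∑-comm (x ∷ xs) ys f = trans (cong (∑ ys (f x) +_) (∑-comm xs ys f))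
                               (sym (∑-distrib-+ ys (f x) (λ y → ∑ xs (λ x → f x y))))

  ∑-++ : (xs ys : List A) (f : A → ℕ) → ∑ (xs ++ ys) f ≡ ∑ xs f + ∑ ys f
  ∑-++ [] ys f = refl
  ∑-++ (x ∷ xs) ys f = trans (cong (f x +_) (∑-++ xs ys f)) (sym (+-assoc (f x) _ _))

  ∑-map : (xs : List A) (g : A → B) (f : B → ℕ) → ∑ (map g xs) f ≡ ∑ xs (f ∘ g)
  ∑-map [] g f = refl
  ∑-map (x ∷ xs) g f = cong (f (g x) +_) (∑-map xs g f)

  ∑-concatMap : (xs : List A) (g : A → List B) (f : B → ℕ) →
                ∑ (concatMap g xs) f ≡ ∑ xs (λ x → ∑ (g x) f)
  ∑-concatMap [] g f = refl
  ∑-concatMap (x ∷ xs) g f =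
    trans (∑-++ (g x) (concatMap g xs) f) (cong (∑ (g x) f +_) (∑-concatMap xs g f))

  length-filter≡count : (xs : List A) (P : A → Bool) → length (filter (T? ∘ P) xs) ≡ count xs P
  length-filter≡count [] P = refl
  length-filter≡count (x ∷ xs) P with P x
  ... | true = cong suc (length-filter≡count xs P)
  ... | false = length-filter≡count xs P

  count-pos⇒∃ : (xs : List A) (P : A → Bool) → 1 ≤ count xs P → ∃[ a ] T (P a)
  count-pos⇒∃ (x ∷ xs) P pos with P x in Px
  ... | true = x , subst T (sym Px) _
  ... | false = count-pos⇒∃ xs P pos

  ∄⇒count≡0 : (xs : List A) (P : A → Bool) → (∀ a → ¬ T (P a)) → count xs P ≡ 0
  ∄⇒count≡0 [] P ∄ = refl
  ∄⇒count≡0 (x ∷ xs) P ∄ with P x in Px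
  ... | true = ⊥-elim (∄ x (subst T (sym Px) _))
  ... | false = ∄⇒count≡0 xs P ∄

  ∑-one : (xs : List A) → ∑ xs (λ _ → 1) ≡ length xs
  ∑-one [] = refl
  ∑-one (x ∷ xs) = cong suc (∑-one xs)

  ∑-allFin-suc : ∀ n (f : Fin (suc n) → ℕ) →
                 ∑ (allFin (suc n)) f ≡ f Fin.zero + ∑ (allFin n) (f ∘ Fin.suc)
  ∑-allFin-suc n f = cong (f Fin.zero +_) (begin
    ∑ (List.tabulate Fin.suc) f    ≡⟨ cong (λ xs → ∑ xs f) (map-tabulate id Fin.suc) ⟨
    ∑ (map Fin.suc (allFin n)) f   ≡⟨ ∑-map (allFin n) Fin.suc f ⟩
    ∑ (allFin n) (f ∘ Fin.suc)     ∎)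
    where open ≡-Reasoning

  ∑-allFin-one : ∀ n → ∑ (allFin n) (λ _ → 1) ≡ n
  ∑-allFin-one n = trans (∑-one (allFin n)) (length-tabulate id)

  count-allFin-≡ : ∀ n (a : Fin n) → count (allFin n) (λ i → does (i Fin.≟ a)) ≡ 1
  count-allFin-≡ (suc n) Fin.zero =
    trans (∑-allFin-suc n (λ i → ⟦ does (i Fin.≟ Fin.zero) ⟧)) (cong suc (∑-zero (allFin n)))
  count-allFin-≡ (suc n) (Fin.suc a) =
    trans (∑-allFin-suc n (λ i → ⟦ does (i Fin.≟ Fin.suc a) ⟧)) (count-allFin-≡ n a)

  module Enumeration {A : Set} (_≟_ : DecidableEquality A) (xs : List A)
                     (once : ∀ a → count xs (λ c → does (c ≟ a)) ≡ 1) where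

    _∖_ : (A → Bool) → A → A → Bool
    (P ∖ a) c = P c ∧ not (does (c ≟ a))

    T-∖ : ∀ P a {c} → T ((P ∖ a) c) ⇔ (T (P c) × c ≢ a)
    T-∖ P a {c} with c ≟ a | P c
    ... | yes c≡a | true = mk⇔ (λ ()) (λ (_ , c≢a) → c≢a c≡a)
    ... | yes _ | false = mk⇔ (λ ()) proj₁
    ... | no c≢a | true = mk⇔ (λ _ → _ , c≢a) _
    ... | no _ | false = mk⇔ (λ ()) proj₁

    count-pos : (P : A → Bool) {a : A} → T (P a) → 1 ≤ count xs P
    count-pos P {a} Pa = subst (_≤ count xs P) (once a) (∑-mono-≤ xs point)
      where
      point : ∀ c → ⟦ does (c ≟ a) ⟧ ≤ ⟦ P c ⟧
      point c with c ≟ a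
      ... | no _ = z≤n
      ... | yes refl with P c
      ... | true = s≤s z≤n

    count-∖ : (P : A → Bool) {a : A} → T (P a) → count xs P ≡ suc (count xs (P ∖ a))
    count-∖ P {a} Pa = begin
      count xs P                                      ≡⟨ ∑-cong xs split ⟩
      ∑ xs (λ c → ⟦ (P ∖ a) c ⟧ + ⟦ does (c ≟ a) ⟧)  ≡⟨ ∑-distrib-+ xs _ _ ⟩
      count xs (P ∖ a) + count xs (λ c → does (c ≟ a)) ≡⟨ cong (count xs (P ∖ a) +_) (once a) ⟩
      count xs (P ∖ a) + 1                            ≡⟨ +-comm _ 1 ⟩
      suc (count xs (P ∖ a))                          ∎
      where
      open ≡-Reasoning
      split : ∀ c → ⟦ P c ⟧ ≡ ⟦ (P ∖ a) c ⟧ + ⟦ does (c ≟ a) ⟧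
      split c with c ≟ a
      ... | yes refl with P c
      ... | true = refl
      split c | no _ with P c
      ... | true = refl
      ... | false = refl

    count≡1⇒unique : (P : A → Bool) → count xs P ≡ 1 → ∀ {a b} → T (P a) → T (P b) → b ≡ a
    count≡1⇒unique P one {a} {b} Pa Pb with b ≟ a
    ... | yes b≡a = b≡a
    ... | no b≢a = ⊥-elim (1+n≰n (subst (2 ≤_) (trans (sym (count-∖ P Pa)) one)
                            (s≤s (count-pos (P ∖ a) (from (T-∖ P a) (Pb , b≢a))))))

    unique⇒count≤1 : (P : A → Bool) → (∀ {a b} → T (P a) → T (P b) → a ≡ b) → count xs P ≤ 1
    unique⇒count≤1 P unique with count xs P in c
    ... | zero = z≤n
    ... | suc _ with count-pos⇒∃ xs P (subst (1 ≤_) (sym c) (s≤s z≤n))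
    ... | a , Pa =
      ≤-reflexive (trans (sym c) (trans (count-∖ P Pa) (cong suc (∄⇒count≡0 xs (P ∖ a) ∄b))))
      where
      ∄b : ∀ b → ¬ T ((P ∖ a) b)
      ∄b b P∖ab = let (Pb , b≢a) = to (T-∖ P a) P∖ab in b≢a (unique Pb Pa)

    count≡2⇒pair : (P : A → Bool) → count xs P ≡ 2 →
                   ∃[ a ] ∃[ b ] a ≢ b × T (P a) × T (P b) × (∀ c → T (P c) → c ≡ a ⊎ c ≡ b)
    count≡2⇒pair P two with count-pos⇒∃ xs P (subst (1 ≤_) (sym two) (s≤s z≤n))
    ... | a , Pa with count-pos⇒∃ xs (P ∖ a) (subst (1 ≤_) (sym one) (s≤s z≤n))
      where
      one : count xs (P ∖ a) ≡ 1
      one = suc-injective (trans (sym (count-∖ P Pa)) two)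
    ... | b , P∖ab = a , b , (λ a≡b → b≢a (sym a≡b)) , Pa , Pb , cover
      where
      Pb = proj₁ (to (T-∖ P a) P∖ab)
      b≢a = proj₂ (to (T-∖ P a) P∖ab)
      none : count xs ((P ∖ a) ∖ b) ≡ 0
      none = suc-injective (trans (sym (count-∖ (P ∖ a) P∖ab))
                                  (suc-injective (trans (sym (count-∖ P Pa)) two)))
      cover : ∀ c → T (P c) → c ≡ a ⊎ c ≡ b
      cover c Pc with c ≟ a | c ≟ b
      ... | yes c≡a | _ = inj₁ c≡a
      ... | no _ | yes c≡b = inj₂ c≡b
      ... | no c≢a | no c≢b = ⊥-elim (1+n≰n (subst (1 ≤_) none
              (count-pos ((P ∖ a) ∖ b) (from (T-∖ (P ∖ a) b) (from (T-∖ P a) (Pc , c≢a) , c≢b)))))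

module HammingGraph (k : ℕ) where
  open Counting

  m : ℕ
  m = suc k

  ℤₘ : Set
  ℤₘ = Fin m

  infixl 6 _+ₘ_
  _+ₘ_ : ℤₘ → ℤₘ → ℤₘ
  _+ₘ_ = addₘ

  -ₘ_ : ℤₘ → ℤₘ
  -ₘ_ = negₘ

  toℕ-+ₘ : ∀ a b → toℕ (a +ₘ b) ≡ (toℕ a + toℕ b) % m
  toℕ-+ₘ a b = toℕ-fromℕ< (m%n<n (toℕ a + toℕ b) m)

  toℕ-negₘ : ∀ a → toℕ (-ₘ a) ≡ (m ∸ toℕ a) % m
  toℕ-negₘ a = toℕ-fromℕ< (m%n<n (m ∸ toℕ a) m)

  [x%m+y]%m≡[x+y]%m : ∀ x y → (x % m + y) % m ≡ (x + y) % m
  [x%m+y]%m≡[x+y]%m x y = begin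
    (x % m + y) % m         ≡⟨ %-distribˡ-+ (x % m) y m ⟩
    (x % m % m + y % m) % m ≡⟨ cong (λ z → (z + y % m) % m) (m%n%n≡m%n x m) ⟩
    (x % m + y % m) % m     ≡⟨ %-distribˡ-+ x y m ⟨
    (x + y) % m             ∎
    where open ≡-Reasoning

  [x+y%m]%m≡[x+y]%m : ∀ x y → (x + y % m) % m ≡ (x + y) % m
  [x+y%m]%m≡[x+y]%m x y = begin
    (x + y % m) % m ≡⟨ cong (_% m) (+-comm x (y % m)) ⟩
    (y % m + x) % m ≡⟨ [x%m+y]%m≡[x+y]%m y x ⟩
    (y + x) % m     ≡⟨ cong (_% m) (+-comm y x) ⟩
    (x + y) % m     ∎
    where open ≡-Reasoning

  +ₘ-comm : ∀ a b → a +ₘ b ≡ b +ₘ a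
  +ₘ-comm a b = toℕ-injective (begin
    toℕ (a +ₘ b)          ≡⟨ toℕ-+ₘ a b ⟩
    (toℕ a + toℕ b) % m   ≡⟨ cong (_% m) (+-comm (toℕ a) (toℕ b)) ⟩
    (toℕ b + toℕ a) % m   ≡⟨ toℕ-+ₘ b a ⟨
    toℕ (b +ₘ a)          ∎)
    where open ≡-Reasoning

  +ₘ-assoc : ∀ a b c → (a +ₘ b) +ₘ c ≡ a +ₘ (b +ₘ c)
  +ₘ-assoc a b c = toℕ-injective (begin
    toℕ ((a +ₘ b) +ₘ c)                ≡⟨ toℕ-+ₘ (a +ₘ b) c ⟩
    (toℕ (a +ₘ b) + toℕ c) % m         ≡⟨ cong (λ z → (z + toℕ c) % m) (toℕ-+ₘ a b) ⟩
    ((toℕ a + toℕ b) % m + toℕ c) % m  ≡⟨ [x%m+y]%m≡[x+y]%m (toℕ a + toℕ b) (toℕ c) ⟩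
    (toℕ a + toℕ b + toℕ c) % m        ≡⟨ cong (_% m) (+-assoc (toℕ a) (toℕ b) (toℕ c)) ⟩
    (toℕ a + (toℕ b + toℕ c)) % m      ≡⟨ [x+y%m]%m≡[x+y]%m (toℕ a) (toℕ b + toℕ c) ⟨
    (toℕ a + (toℕ b + toℕ c) % m) % m  ≡⟨ cong (λ z → (toℕ a + z) % m) (toℕ-+ₘ b c) ⟨
    (toℕ a + toℕ (b +ₘ c)) % m         ≡⟨ toℕ-+ₘ a (b +ₘ c) ⟨
    toℕ (a +ₘ (b +ₘ c))                ∎)
    where open ≡-Reasoning

  +ₘ-identityˡ : ∀ a → Fin.zero +ₘ a ≡ a
  +ₘ-identityˡ a = toℕ-injective (trans (toℕ-+ₘ Fin.zero a) (m<n⇒m%n≡m (toℕ<n a)))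

  +ₘ-inverseʳ : ∀ a → a +ₘ (-ₘ a) ≡ Fin.zero
  +ₘ-inverseʳ a = toℕ-injective (begin
    toℕ (a +ₘ (-ₘ a))               ≡⟨ toℕ-+ₘ a (-ₘ a) ⟩
    (toℕ a + toℕ (-ₘ a)) % m        ≡⟨ cong (λ z → (toℕ a + z) % m) (toℕ-negₘ a) ⟩
    (toℕ a + (m ∸ toℕ a) % m) % m   ≡⟨ [x+y%m]%m≡[x+y]%m (toℕ a) (m ∸ toℕ a) ⟩
    (toℕ a + (m ∸ toℕ a)) % m       ≡⟨ cong (_% m) (m+[n∸m]≡n (<⇒≤ (toℕ<n a))) ⟩
    m % m                           ≡⟨ n%n≡0 m ⟩
    0                               ∎)
    where open ≡-Reasoning

  +ₘ-isAbelianGroup : IsAbelianGroup _≡_ _+ₘ_ Fin.zero -ₘ_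
  +ₘ-isAbelianGroup = record
    { isGroup = record
      { isMonoid = record
        { isSemigroup = record
          { isMagma = record { isEquivalence = isEquivalence ; ∙-cong = cong₂ _+ₘ_ }
          ; assoc = +ₘ-assoc }
        ; identity = +ₘ-identityˡ , λ a → trans (+ₘ-comm a Fin.zero) (+ₘ-identityˡ a) }
      ; inverse = (λ a → trans (+ₘ-comm (-ₘ a) a) (+ₘ-inverseʳ a)) , +ₘ-inverseʳ
      ; ⁻¹-cong = cong -ₘ_ }
    ; comm = +ₘ-comm }

  ℤₘ-abelianGroup : AbelianGroup _ _
  ℤₘ-abelianGroup = record { isAbelianGroup = +ₘ-isAbelianGroup }

  module ℤₘ-Properties = AbelianGroupProperties ℤₘ-abelianGroup

  V : ℕ → Set
  V n = Vertex m n

  𝟘 : ∀ {n} → V n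
  𝟘 {n} = replicate n Fin.zero

  ⊕-assoc : ∀ {n} (x y z : V n) → (x ⊕ y) ⊕ z ≡ x ⊕ (y ⊕ z)
  ⊕-assoc [] [] [] = refl
  ⊕-assoc (a ∷ x) (b ∷ y) (c ∷ z) = cong₂ _∷_ (+ₘ-assoc a b c) (⊕-assoc x y z)

  ⊕-comm : ∀ {n} (x y : V n) → x ⊕ y ≡ y ⊕ x
  ⊕-comm [] [] = refl
  ⊕-comm (a ∷ x) (b ∷ y) = cong₂ _∷_ (+ₘ-comm a b) (⊕-comm x y)

  ⊕-identityˡ : ∀ {n} (x : V n) → 𝟘 ⊕ x ≡ x
  ⊕-identityˡ [] = refl
  ⊕-identityˡ (a ∷ x) = cong₂ _∷_ (+ₘ-identityˡ a) (⊕-identityˡ x)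

  ⊕-inverseʳ : ∀ {n} (x : V n) → x ⊕ (⊖ x) ≡ 𝟘
  ⊕-inverseʳ [] = refl
  ⊕-inverseʳ (a ∷ x) = cong₂ _∷_ (+ₘ-inverseʳ a) (⊕-inverseʳ x)

  ⊕-isAbelianGroup : ∀ n → IsAbelianGroup _≡_ (_⊕_ {m} {n}) 𝟘 ⊖_
  ⊕-isAbelianGroup n = record
    { isGroup = record
      { isMonoid = record
        { isSemigroup = record
          { isMagma = record { isEquivalence = isEquivalence ; ∙-cong = cong₂ _⊕_ }
          ; assoc = ⊕-assoc }
        ; identity = ⊕-identityˡ , λ x → trans (⊕-comm x 𝟘) (⊕-identityˡ x) }
      ; inverse = (λ x → trans (⊕-comm (⊖ x) x) (⊕-inverseʳ x)) , ⊕-inverseʳ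
      ; ⁻¹-cong = cong ⊖_ }
    ; comm = ⊕-comm }

  ℤₘⁿ-abelianGroup : ℕ → AbelianGroup _ _
  ℤₘⁿ-abelianGroup n = record { isAbelianGroup = ⊕-isAbelianGroup n }

  module ℤₘⁿ-Properties n = AbelianGroupProperties (ℤₘⁿ-abelianGroup n)

  mismatch≤1 : ∀ b → (if b then 0 else 1) ≤ 1
  mismatch≤1 true = z≤n
  mismatch≤1 false = s≤s z≤n

  dist-⊕ʳ : ∀ {n} (u v x : V n) → dist (u ⊕ x) (v ⊕ x) ≡ dist u v
  dist-⊕ʳ [] [] [] = refl
  dist-⊕ʳ (a ∷ u) (b ∷ v) (c ∷ x) = cong₂ (λ t r → (if t then 0 else 1) + r)
    (does-⇔ (a +ₘ c Fin.≟ b +ₘ c) (a Fin.≟ b)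
            (mk⇔ (ℤₘ-Properties.∙-cancelʳ c a b) (cong (_+ₘ c))))
    (dist-⊕ʳ u v x)

  dist-⊖ : ∀ {n} (u v : V n) → dist (⊖ u) (⊖ v) ≡ dist u v
  dist-⊖ [] [] = refl
  dist-⊖ (a ∷ u) (b ∷ v) = cong₂ (λ t r → (if t then 0 else 1) + r)
    (does-⇔ (-ₘ a Fin.≟ -ₘ b) (a Fin.≟ b) (mk⇔ ℤₘ-Properties.⁻¹-injective (cong -ₘ_)))
    (dist-⊖ u v)

  dist-self : ∀ {n} (u : V n) → dist u u ≡ 0
  dist-self [] = refl
  dist-self (a ∷ u) rewrite dec-true (a Fin.≟ a) refl = dist-self u

  dist≡0⇒≡ : ∀ {n} (u v : V n) → dist u v ≡ 0 → u ≡ v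
  dist≡0⇒≡ [] [] _ = refl
  dist≡0⇒≡ (a ∷ u) (b ∷ v) d≡0 with a Fin.≟ b
  ... | yes a≡b = cong₂ _∷_ a≡b (dist≡0⇒≡ u v d≡0)

  reflect : ∀ {n} → V n → V n → V n
  reflect t x = (⊖ x) ⊕ t

  reflect-involutive : ∀ {n} (t x : V n) → reflect t (reflect t x) ≡ x
  reflect-involutive {n} t x = begin
    (⊖ ((⊖ x) ⊕ t)) ⊕ t        ≡⟨ cong (_⊕ t) (⁻¹-∙-comm (⊖ x) t) ⟨
    ((⊖ (⊖ x)) ⊕ (⊖ t)) ⊕ t    ≡⟨ ⊕-assoc (⊖ (⊖ x)) (⊖ t) t ⟩
    (⊖ (⊖ x)) ⊕ ((⊖ t) ⊕ t)    ≡⟨ cong₂ _⊕_ (⁻¹-involutive x) (inverseˡ t) ⟩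
    x ⊕ 𝟘                      ≡⟨ identityʳ x ⟩
    x                          ∎
    where
    open ≡-Reasoning
    open ℤₘⁿ-Properties n using (⁻¹-∙-comm; ⁻¹-involutive)
    open AbelianGroup (ℤₘⁿ-abelianGroup n) using (inverseˡ; identityʳ)

  reflect-⊕ : ∀ {n} (a b : V n) → reflect (a ⊕ b) a ≡ b
  reflect-⊕ {n} = ℤₘⁿ-Properties.\\-leftDividesʳ n

  reflect-injective : ∀ {n} (t : V n) {x y} → reflect t x ≡ reflect t y → x ≡ y
  reflect-injective t {x} {y} Rx≡Ry =
    trans (sym (reflect-involutive t x)) (trans (cong (reflect t) Rx≡Ry) (reflect-involutive t y))

  dist-reflect : ∀ {n} (t x y : V n) → dist (reflect t x) (reflect t y) ≡ dist x y
  dist-reflect t x y = trans (dist-⊕ʳ (⊖ x) (⊖ y) t) (dist-⊖ x y)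

  midpoint-dist-≤ : ∀ {n} (v a b : V n) → reflect (a ⊕ b) v ≡ v →
                    dist v (reflect (a ⊕ a) b) ≤ dist v a
  midpoint-dist-≤ [] [] [] _ = z≤n
  midpoint-dist-≤ (x ∷ v) (y ∷ a) (z ∷ b) mid with ∷-injective mid
  ... | mid₀ , mid with x Fin.≟ y
  ... | no _ = +-mono-≤ (mismatch≤1 (does (x Fin.≟ ((-ₘ z) +ₘ (y +ₘ y)))))
                        (midpoint-dist-≤ v a b mid)
  ... | yes refl with x Fin.≟ ((-ₘ z) +ₘ (x +ₘ x))
  ...   | yes _ = midpoint-dist-≤ v a b mid
  ...   | no x≢2x-z = ⊥-elim (x≢2x-z (sym (begin
    (-ₘ z) +ₘ (x +ₘ x) ≡⟨ cong (λ w → (-ₘ w) +ₘ (x +ₘ x)) (trans (sym (\\-leftDividesʳ x z)) mid₀) ⟩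
    (-ₘ x) +ₘ (x +ₘ x) ≡⟨ \\-leftDividesʳ x x ⟩
    x                  ∎)))
    where
    open ≡-Reasoning
    open ℤₘ-Properties using (\\-leftDividesʳ)

  near : ∀ {n} → V n → V n → Bool
  near v w = dist v w ≤ᵇ 1

  near⇒∈N : ∀ {n} (v w : V n) → T (near v w) → w ∈N[ v ]
  near⇒∈N v w t with dist v w in d
  ... | zero = inj₁ (sym (dist≡0⇒≡ v w d))
  ... | suc zero = inj₂ refl

  ∈N⇒near : ∀ {n} (v w : V n) → w ∈N[ v ] → T (near v w)
  ∈N⇒near v w (inj₁ refl) rewrite dist-self v = _
  ∈N⇒near v w (inj₂ d) rewrite d = _

  differ⇒1≤dist : ∀ {n} (u v : V n) {i} → lookup u i ≢ lookup v i → 1 ≤ dist u v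
  differ⇒1≤dist (a ∷ u) (b ∷ v) {Fin.zero} a≢b rewrite dec-false (a Fin.≟ b) a≢b = s≤s z≤n
  differ⇒1≤dist (a ∷ u) (b ∷ v) {Fin.suc i} ui≢vi = ≤-trans (differ⇒1≤dist u v ui≢vi) (m≤n+m _ _)

  differ₂⇒2≤dist : ∀ {n} (u v : V n) {i j} → i ≢ j →
                   lookup u i ≢ lookup v i → lookup u j ≢ lookup v j → 2 ≤ dist u v
  differ₂⇒2≤dist (a ∷ u) (b ∷ v) {Fin.zero} {Fin.zero} i≢j _ _ = ⊥-elim (i≢j refl)
  differ₂⇒2≤dist (a ∷ u) (b ∷ v) {Fin.zero} {Fin.suc j} _ a≢b uj≢vj
    rewrite dec-false (a Fin.≟ b) a≢b = s≤s (differ⇒1≤dist u v uj≢vj)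
  differ₂⇒2≤dist (a ∷ u) (b ∷ v) {Fin.suc i} {Fin.zero} _ ui≢vi a≢b
    rewrite dec-false (a Fin.≟ b) a≢b = s≤s (differ⇒1≤dist u v ui≢vi)
  differ₂⇒2≤dist (a ∷ u) (b ∷ v) {Fin.suc i} {Fin.suc j} i≢j ui≢vi uj≢vj =
    ≤-trans (differ₂⇒2≤dist u v (i≢j ∘ cong Fin.suc) ui≢vi uj≢vj) (m≤n+m _ _)

  differ₂⇒¬near : ∀ {n} (u v : V n) {i j} → i ≢ j →
                  lookup u i ≢ lookup v i → lookup u j ≢ lookup v j → ¬ T (near u v)
  differ₂⇒¬near u v i≢j ui≢vi uj≢vj near-u-v =
    1+n≰n (≤-trans (differ₂⇒2≤dist u v i≢j ui≢vi uj≢vj) (≤ᵇ⇒≤ (dist u v) 1 near-u-v))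

  ≢⇒differ : ∀ {n} (u v : V n) → u ≢ v → ∃[ i ] lookup u i ≢ lookup v i
  ≢⇒differ [] [] u≢v = ⊥-elim (u≢v refl)
  ≢⇒differ (a ∷ u) (b ∷ v) u≢v with a Fin.≟ b
  ... | no a≢b = Fin.zero , a≢b
  ... | yes refl with ≢⇒differ u v (u≢v ∘ cong (a ∷_))
  ... | i , ui≢vi = Fin.suc i , ui≢vi

  dist-update≤1 : ∀ {n} (u : V n) i y → dist u (u [ i ]≔ y) ≤ 1
  dist-update≤1 (x ∷ u) Fin.zero y
    rewrite dist-self u | +-identityʳ (if does (x Fin.≟ y) then 0 else 1) =
    mismatch≤1 (does (x Fin.≟ y))
  dist-update≤1 (x ∷ u) (Fin.suc i) y rewrite dec-true (x Fin.≟ x) refl = dist-update≤1 u i y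

  _≟V_ : ∀ {n} → DecidableEquality (V n)
  _≟V_ = ≡-dec Fin._≟_

  allV : ∀ n → List (V n)
  allV n = allVertices m n

  ∑-allV-suc : ∀ n (f : V (suc n) → ℕ) →
               ∑ (allV (suc n)) f ≡ ∑ (allFin m) (λ x → ∑ (allV n) (λ v → f (x ∷ v)))
  ∑-allV-suc n f = trans (∑-concatMap (allFin m) (λ x → map (x ∷_) (allV n)) f)
                         (∑-cong (allFin m) (λ x → ∑-map (allV n) (x ∷_) f))

  count-allV-≡ : ∀ n (a : V n) → count (allV n) (λ c → does (c ≟V a)) ≡ 1
  count-allV-≡ zero [] = refl
  count-allV-≡ (suc n) (a ∷ as) = begin
    count (allV (suc n)) (λ c → does (c ≟V (a ∷ as)))
      ≡⟨ ∑-allV-suc n _ ⟩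
    ∑ (allFin m) (λ x → ∑ (allV n) (λ v → ⟦ does (x Fin.≟ a) ∧ does (v ≟V as) ⟧))
      ≡⟨ ∑-cong (allFin m) (λ x → ∑-cong (allV n) (λ v → ⟦∧⟧ (does (x Fin.≟ a)) _)) ⟩
    ∑ (allFin m) (λ x → ∑ (allV n) (λ v → ⟦ does (x Fin.≟ a) ⟧ * ⟦ does (v ≟V as) ⟧))
      ≡⟨ ∑-cong (allFin m) (λ x → ∑-*ˡ (allV n) ⟦ does (x Fin.≟ a) ⟧ _) ⟩
    ∑ (allFin m) (λ x → ⟦ does (x Fin.≟ a) ⟧ * count (allV n) (λ v → does (v ≟V as)))
      ≡⟨ ∑-cong (allFin m) (λ x → cong (⟦ does (x Fin.≟ a) ⟧ *_) (count-allV-≡ n as)) ⟩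
    ∑ (allFin m) (λ x → ⟦ does (x Fin.≟ a) ⟧ * 1)
      ≡⟨ ∑-cong (allFin m) (λ x → *-identityʳ _) ⟩
    count (allFin m) (λ x → does (x Fin.≟ a))
      ≡⟨ count-allFin-≡ m a ⟩
    1 ∎
    where open ≡-Reasoning

  ∑-allV-one : ∀ n → ∑ (allV n) (λ _ → 1) ≡ m ^ n
  ∑-allV-one zero = refl
  ∑-allV-one (suc n) = begin
    ∑ (allV (suc n)) (λ _ → 1)
      ≡⟨ ∑-allV-suc n _ ⟩
    ∑ (allFin m) (λ _ → ∑ (allV n) (λ _ → 1))
      ≡⟨ ∑-cong (allFin m) (λ _ → trans (∑-allV-one n) (sym (*-identityʳ _))) ⟩
    ∑ (allFin m) (λ _ → m ^ n * 1)
      ≡⟨ ∑-*ˡ (allFin m) (m ^ n) _ ⟩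
    m ^ n * ∑ (allFin m) (λ _ → 1)
      ≡⟨ cong (m ^ n *_) (∑-allFin-one m) ⟩
    m ^ n * m
      ≡⟨ *-comm (m ^ n) m ⟩
    m ^ suc n ∎
    where open ≡-Reasoning

  ⟦1+dist≤ᵇ1⟧≡⟦≟⟧ : ∀ {n} (v w : V n) → ⟦ suc (dist v w) ≤ᵇ 1 ⟧ ≡ ⟦ does (v ≟V w) ⟧
  ⟦1+dist≤ᵇ1⟧≡⟦≟⟧ v w with v ≟V w
  ... | yes refl rewrite dist-self v = refl
  ... | no v≢w with dist v w in d
  ... | zero = ⊥-elim (v≢w (dist≡0⇒≡ v w d))
  ... | suc _ = refl

  ball-size : ∀ n (c : V n) → count (allV n) (λ v → near v c) ≡ suc (n * k)
  ball-size zero [] = refl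
  ball-size (suc n) (c ∷ cs) = begin
    count (allV (suc n)) (λ v → near v (c ∷ cs))
      ≡⟨ ∑-allV-suc n _ ⟩
    ∑ (allFin m) (λ x → count (allV n) (λ v → near (x ∷ v) (c ∷ cs)))
      ≡⟨ ∑-cong (allFin m) column ⟩
    ∑ (allFin m) (λ x → n * k * ⟦ does (x Fin.≟ c) ⟧ + 1)
      ≡⟨ ∑-distrib-+ (allFin m) (λ x → n * k * ⟦ does (x Fin.≟ c) ⟧) (λ _ → 1) ⟩
    ∑ (allFin m) (λ x → n * k * ⟦ does (x Fin.≟ c) ⟧) + ∑ (allFin m) (λ _ → 1)
      ≡⟨ cong₂ _+_ (∑-*ˡ (allFin m) (n * k) _) (∑-allFin-one m) ⟩
    n * k * count (allFin m) (λ x → does (x Fin.≟ c)) + m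
      ≡⟨ cong (λ z → n * k * z + m) (count-allFin-≡ m c) ⟩
    n * k * 1 + suc k
      ≡⟨ cong (_+ suc k) (*-identityʳ (n * k)) ⟩
    n * k + suc k
      ≡⟨ +-suc (n * k) k ⟩
    suc (n * k + k)
      ≡⟨ cong suc (+-comm (n * k) k) ⟩
    suc (suc n * k) ∎
    where
    open ≡-Reasoning
    column : ∀ x → count (allV n) (λ v → near (x ∷ v) (c ∷ cs)) ≡ n * k * ⟦ does (x Fin.≟ c) ⟧ + 1
    column x with x Fin.≟ c
    ... | yes _ = trans (ball-size n cs) (trans (cong suc (sym (*-identityʳ (n * k)))) (+-comm 1 _))
    ... | no _ = trans (∑-cong (allV n) (λ v → ⟦1+dist≤ᵇ1⟧≡⟦≟⟧ v cs))
                       (trans (count-allV-≡ n cs) (cong (_+ 1) (sym (*-zeroʳ (n * k)))))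

module LowerBound (k n : ℕ) (C : Code (suc k) n)
                  (subgroup : IsSubgroup C) (identifying : IsIdentifyingCode C) where
  open Counting
  open HammingGraph k
  open Enumeration (_≟V_ {n}) (allV n) (count-allV-≡ n)
  open ℤₘⁿ-Properties n using (∙-cancelˡ)

  J : V n → V n → Bool
  J v c = C c ∧ near v c

  J⇔∈J : ∀ v c → T (J v c) ⇔ c ∈J[ C , v ]
  J⇔∈J v c = mk⇔ (λ Jvc → let (Cc , near-v-c) = to T-∧ Jvc in near⇒∈N v c near-v-c , Cc)
                 (λ (c∈N , Cc) → from T-∧ (Cc , ∈N⇒near v c c∈N))

  J-injective : ∀ {u v} → (∀ c → T (J u c) ⇔ T (J v c)) → u ≡ v
  J-injective {u} {v} same with u ≟V v
  ... | yes u≡v = u≡v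
  ... | no u≢v = ⊥-elim (proj₂ identifying u v u≢v λ c →
          mk⇔ (λ c∈Ju → to (J⇔∈J v c) (to (same c) (from (J⇔∈J u c) c∈Ju)))
              (λ c∈Jv → to (J⇔∈J u c) (from (same c) (from (J⇔∈J v c) c∈Jv))))

  ⊕-closed : ∀ {x y} → T (C x) → T (C y) → T (C (x ⊕ y))
  ⊕-closed {x} {y} = proj₁ (proj₂ subgroup) x y

  C-reflect : ∀ {t x} → T (C t) → T (C x) → T (C (reflect t x))
  C-reflect {t} {x} Ct Cx = ⊕-closed (proj₂ (proj₂ subgroup) x Cx) Ct

  J-reflect : ∀ {t} → T (C t) → ∀ v c → T (J v c) → T (J (reflect t v) (reflect t c))
  J-reflect {t} Ct v c Jvc = from T-∧ (C-reflect Ct Cc ,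
    subst (λ d → T (d ≤ᵇ 1)) (sym (dist-reflect t v c)) near-v-c)
    where
    Cc = proj₁ (to T-∧ Jvc)
    near-v-c = proj₂ (to T-∧ Jvc)

  J-unreflect : ∀ {t} → T (C t) → ∀ v c → T (J (reflect t v) c) → T (J v (reflect t c))
  J-unreflect {t} Ct v c =
    subst (λ w → T (J w (reflect t c))) (reflect-involutive t v) ∘ J-reflect Ct (reflect t v) c

  _∈⟨_,_⟩ : V n → V n → V n → Set
  c ∈⟨ a , b ⟩ = c ≡ a ⊎ c ≡ b

  -- J(reflect t v) is the image of J(v), so a reflection preserving J(v) = {a, b} must fix v.
  reflect-fixes : ∀ {t v a b} → T (C t) → T (J v a) → T (J v b) →
                  (∀ c → T (J v c) → c ∈⟨ a , b ⟩) →
                  (∀ c → c ∈⟨ a , b ⟩ → reflect t c ∈⟨ a , b ⟩) →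
                  reflect t v ≡ v
  reflect-fixes {t} {v} {a} {b} Ct Ja Jb cover stable = J-injective λ c →
    mk⇔ (λ J[Rv]c → member (subst (_∈⟨ a , b ⟩) (reflect-involutive t c)
                                   (stable _ (cover _ (J-unreflect Ct v c J[Rv]c)))))
        (λ Jvc → subst (T ∘ J (reflect t v)) (reflect-involutive t c)
                       (J-reflect Ct v (reflect t c) (member (stable c (cover c Jvc)))))
    where
    member : ∀ {c} → c ∈⟨ a , b ⟩ → T (J v c)
    member (inj₁ refl) = Ja
    member (inj₂ refl) = Jb

  |J| : V n → ℕ
  |J| v = count (allV n) (J v)

  |J|≢2 : ∀ v → |J| v ≢ 2
  |J|≢2 v two with count≡2⇒pair (J v) two
  ... | a , b , a≢b , Ja , Jb , cover = a≢b (reflected-midpoint (cover d Jd))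
    where
    Ca = proj₁ (to T-∧ Ja)
    Cb = proj₁ (to T-∧ Jb)
    swap : ∀ c → c ∈⟨ a , b ⟩ → reflect (a ⊕ b) c ∈⟨ a , b ⟩
    swap _ (inj₁ refl) = inj₂ (reflect-⊕ a b)
    swap _ (inj₂ refl) = inj₁ (trans (cong (λ t → reflect t b) (⊕-comm a b)) (reflect-⊕ b a))
    -- 2v = a + b, so d = 2a − b agrees with v wherever a does
    midpoint : reflect (a ⊕ b) v ≡ v
    midpoint = reflect-fixes (⊕-closed Ca Cb) Ja Jb cover swap
    d = reflect (a ⊕ a) b
    Jd : T (J v d)
    Jd = from T-∧ (C-reflect (⊕-closed Ca Ca) Cb ,
           ≤⇒≤ᵇ (≤-trans (midpoint-dist-≤ v a b midpoint) (≤ᵇ⇒≤ _ 1 (proj₂ (to T-∧ Ja)))))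
    reflected-midpoint : d ∈⟨ a , b ⟩ → a ≡ b
    reflected-midpoint (inj₁ d≡a) = sym (reflect-injective (a ⊕ a) (trans d≡a (sym (reflect-⊕ a a))))
    reflected-midpoint (inj₂ d≡b) =
      ∙-cancelˡ a a b (∙-cancelˡ (⊖ v) (a ⊕ a) (a ⊕ b) (trans fixed (sym midpoint)))
      where
      stable : ∀ c → c ∈⟨ a , b ⟩ → reflect (a ⊕ a) c ∈⟨ a , b ⟩
      stable _ (inj₁ refl) = inj₁ (reflect-⊕ a a)
      stable _ (inj₂ refl) = inj₂ d≡b
      fixed : reflect (a ⊕ a) v ≡ v
      fixed = reflect-fixes (⊕-closed Ca Ca) Ja Jb cover stable

  |J|-pos : ∀ v → 1 ≤ |J| v
  |J|-pos v = count-pos (J v) (from (J⇔∈J v _) (proj₂ (proj₁ identifying v)))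

  |J|≡1⊎3≤|J| : ∀ v → |J| v ≡ 1 ⊎ 3 ≤ |J| v
  |J|≡1⊎3≤|J| v with |J| v | |J|-pos v | |J|≢2 v
  ... | 1 | _ | _ = inj₁ refl
  ... | 2 | _ | ≢2 = ⊥-elim (≢2 refl)
  ... | suc (suc (suc j)) | _ | _ = inj₂ (s≤s (s≤s (s≤s z≤n)))

  isSingleton : V n → Bool
  isSingleton v = |J| v ≡ᵇ 1

  3≤|J|+2[isSingleton] : ∀ v → 3 ≤ |J| v + 2 * ⟦ isSingleton v ⟧
  3≤|J|+2[isSingleton] v = bound (|J| v) (|J|≡1⊎3≤|J| v)
    where
    bound : ∀ x → x ≡ 1 ⊎ 3 ≤ x → 3 ≤ x + 2 * ⟦ x ≡ᵇ 1 ⟧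
    bound x (inj₁ refl) = ≤-refl
    bound x (inj₂ 3≤x) = ≤-trans 3≤x (m≤m+n x _)

  singletons-unique : ∀ c {u w} → T (isSingleton u ∧ J u c) → T (isSingleton w ∧ J w c) → u ≡ w
  singletons-unique c {u} {w} su∧Juc sw∧Jwc = J-injective λ c′ →
    mk⇔ (λ Juc′ → subst (T ∘ J w) (sym (only u su∧Juc Juc′)) (proj₂ (split w sw∧Jwc)))
        (λ Jwc′ → subst (T ∘ J u) (sym (only w sw∧Jwc Jwc′)) (proj₂ (split u su∧Juc)))
    where
    split : ∀ v → T (isSingleton v ∧ J v c) → T (isSingleton v) × T (J v c)
    split v = to (T-∧ {isSingleton v})
    only : ∀ v → T (isSingleton v ∧ J v c) → ∀ {c′} → T (J v c′) → c′ ≡ c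
    only v sv∧Jvc Jvc′ = let (sv , Jvc) = split v sv∧Jvc in
      count≡1⇒unique (J v) (≡ᵇ⇒≡ (|J| v) 1 sv) Jvc Jvc′

  ⟦x≡ᵇ1⟧≡⟦x≡ᵇ1⟧*x : ∀ x → ⟦ x ≡ᵇ 1 ⟧ ≡ ⟦ x ≡ᵇ 1 ⟧ * x
  ⟦x≡ᵇ1⟧≡⟦x≡ᵇ1⟧*x 0 = refl
  ⟦x≡ᵇ1⟧≡⟦x≡ᵇ1⟧*x 1 = refl
  ⟦x≡ᵇ1⟧≡⟦x≡ᵇ1⟧*x (suc (suc x)) = refl

  -- each codeword is the whole of J v for at most one v
  count-isSingleton≤|C| : count (allV n) isSingleton ≤ count (allV n) C
  count-isSingleton≤|C| = begin
    count (allV n) isSingleton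
      ≡⟨ ∑-cong (allV n) (λ v → ⟦x≡ᵇ1⟧≡⟦x≡ᵇ1⟧*x (|J| v)) ⟩
    ∑ (allV n) (λ v → ⟦ isSingleton v ⟧ * |J| v)
      ≡⟨ ∑-cong (allV n) (λ v → ∑-*ˡ (allV n) ⟦ isSingleton v ⟧ (λ c → ⟦ J v c ⟧)) ⟨
    ∑ (allV n) (λ v → ∑ (allV n) (λ c → ⟦ isSingleton v ⟧ * ⟦ J v c ⟧))
      ≡⟨ ∑-comm (allV n) (allV n) (λ v c → ⟦ isSingleton v ⟧ * ⟦ J v c ⟧) ⟩
    ∑ (allV n) (λ c → ∑ (allV n) (λ v → ⟦ isSingleton v ⟧ * ⟦ J v c ⟧))
      ≡⟨ ∑-cong (allV n) (λ c → ∑-cong (allV n) (λ v → ⟦∧⟧ (isSingleton v) (J v c))) ⟨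
    ∑ (allV n) (λ c → count (allV n) (λ v → isSingleton v ∧ J v c))
      ≤⟨ ∑-mono-≤ (allV n) at-most-one ⟩
    count (allV n) C ∎
    where
    open ≤-Reasoning
    at-most-one : ∀ c → count (allV n) (λ v → isSingleton v ∧ J v c) ≤ ⟦ C c ⟧
    at-most-one c = by-membership (C c) refl
      where
      by-membership : ∀ b → C c ≡ b → count (allV n) (λ v → isSingleton v ∧ J v c) ≤ ⟦ b ⟧
      by-membership true _ = unique⇒count≤1 (λ v → isSingleton v ∧ J v c) (singletons-unique c)
      by-membership false Cc =
        ≤-reflexive (∄⇒count≡0 (allV n) (λ v → isSingleton v ∧ J v c) λ v sv∧Jvc →
          subst T Cc (proj₁ (to (T-∧ {C c}) (proj₂ (to (T-∧ {isSingleton v}) sv∧Jvc)))))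

  ∑|J|≡ball*|C| : ∑ (allV n) |J| ≡ suc (n * k) * count (allV n) C
  ∑|J|≡ball*|C| = begin
    ∑ (allV n) (λ v → ∑ (allV n) (λ c → ⟦ C c ∧ near v c ⟧))
      ≡⟨ ∑-comm (allV n) (allV n) (λ v c → ⟦ C c ∧ near v c ⟧) ⟩
    ∑ (allV n) (λ c → ∑ (allV n) (λ v → ⟦ C c ∧ near v c ⟧))
      ≡⟨ ∑-cong (allV n) (λ c → ∑-cong (allV n) (λ v → ⟦∧⟧ (C c) (near v c))) ⟩
    ∑ (allV n) (λ c → ∑ (allV n) (λ v → ⟦ C c ⟧ * ⟦ near v c ⟧))
      ≡⟨ ∑-cong (allV n) (λ c → ∑-*ˡ (allV n) ⟦ C c ⟧ (λ v → ⟦ near v c ⟧)) ⟩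
    ∑ (allV n) (λ c → ⟦ C c ⟧ * count (allV n) (λ v → near v c))
      ≡⟨ ∑-cong (allV n) (λ c → trans (cong (⟦ C c ⟧ *_) (ball-size n c)) (*-comm ⟦ C c ⟧ _)) ⟩
    ∑ (allV n) (λ c → suc (n * k) * ⟦ C c ⟧)
      ≡⟨ ∑-*ˡ (allV n) (suc (n * k)) (λ c → ⟦ C c ⟧) ⟩
    suc (n * k) * count (allV n) C ∎
    where open ≡-Reasoning

  lower-bound : 3 * m ^ n ≤ count (allV n) C * (n * k + 3)
  lower-bound = begin
    3 * m ^ n
      ≡⟨ cong (3 *_) (∑-allV-one n) ⟨
    3 * ∑ (allV n) (λ _ → 1)
      ≡⟨ ∑-*ˡ (allV n) 3 (λ _ → 1) ⟨
    ∑ (allV n) (λ _ → 3)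
      ≤⟨ ∑-mono-≤ (allV n) 3≤|J|+2[isSingleton] ⟩
    ∑ (allV n) (λ v → |J| v + 2 * ⟦ isSingleton v ⟧)
      ≡⟨ ∑-distrib-+ (allV n) |J| (λ v → 2 * ⟦ isSingleton v ⟧) ⟩
    ∑ (allV n) |J| + ∑ (allV n) (λ v → 2 * ⟦ isSingleton v ⟧)
      ≡⟨ cong₂ _+_ ∑|J|≡ball*|C| (∑-*ˡ (allV n) 2 (λ v → ⟦ isSingleton v ⟧)) ⟩
    suc (n * k) * |C| + 2 * count (allV n) isSingleton
      ≤⟨ +-monoʳ-≤ (suc (n * k) * |C|) (*-monoʳ-≤ 2 count-isSingleton≤|C|) ⟩
    suc (n * k) * |C| + 2 * |C|
      ≡⟨ *-distribʳ-+ |C| (suc (n * k)) 2 ⟨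
    (suc (n * k) + 2) * |C|
      ≡⟨ cong (_* |C|) (+-suc (n * k) 2) ⟨
    (n * k + 3) * |C|
      ≡⟨ *-comm (n * k + 3) |C| ⟩
    |C| * (n * k + 3) ∎
    where
    open ≤-Reasoning
    |C| = count (allV n) C

module UpperBound (k : ℕ) where
  open Counting
  open HammingGraph k
  open AbelianGroup ℤₘ-abelianGroup using (commutativeSemigroup; identityʳ; inverseˡ)
  open Algebra.Properties.CommutativeSemigroup commutativeSemigroup
    using () renaming (interchange to +ₘ-interchange; xy∙z≈zy∙x to xy+z≡zy+x)
  open ℤₘ-Properties
    using (ε⁻¹≈ε; ⁻¹-∙-comm; ∙-cancelˡ; ∙-cancelʳ; ⁻¹-involutive; xyx⁻¹≈y; inverseˡ-unique)

  sumV : ∀ {n} → V n → ℤₘ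
  sumV [] = Fin.zero
  sumV (x ∷ xs) = x +ₘ sumV xs

  zeroSum : ∀ {n} → Code m n
  zeroSum v = does (sumV v Fin.≟ Fin.zero)

  zeroSum⇔ : ∀ {n} (v : V n) → T (zeroSum v) ⇔ sumV v ≡ Fin.zero
  zeroSum⇔ v = T-does⇔ (sumV v Fin.≟ Fin.zero)

  sumV-⊕ : ∀ {n} (x y : V n) → sumV (x ⊕ y) ≡ sumV x +ₘ sumV y
  sumV-⊕ [] [] = sym (+ₘ-identityˡ Fin.zero)
  sumV-⊕ (a ∷ x) (b ∷ y) = trans (cong (a +ₘ b +ₘ_) (sumV-⊕ x y)) (+ₘ-interchange a b (sumV x) (sumV y))

  sumV-⊖ : ∀ {n} (x : V n) → sumV (⊖ x) ≡ -ₘ sumV x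
  sumV-⊖ [] = sym ε⁻¹≈ε
  sumV-⊖ (a ∷ x) = trans (cong (-ₘ a +ₘ_) (sumV-⊖ x)) (⁻¹-∙-comm a (sumV x))

  sumV-𝟘 : ∀ n → sumV (𝟘 {n}) ≡ Fin.zero
  sumV-𝟘 zero = refl
  sumV-𝟘 (suc n) = trans (cong (Fin.zero +ₘ_) (sumV-𝟘 n)) (+ₘ-identityˡ Fin.zero)

  zeroSum-isSubgroup : ∀ n → IsSubgroup (zeroSum {n})
  zeroSum-isSubgroup n =
    (𝟘 , ⊕-identityˡ , from (zeroSum⇔ (𝟘 {n})) (sumV-𝟘 n)) ,
    (λ x y Cx Cy → from (zeroSum⇔ (x ⊕ y)) (begin
      sumV (x ⊕ y)           ≡⟨ sumV-⊕ x y ⟩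
      sumV x +ₘ sumV y       ≡⟨ cong₂ _+ₘ_ (to (zeroSum⇔ x) Cx) (to (zeroSum⇔ y) Cy) ⟩
      Fin.zero +ₘ Fin.zero   ≡⟨ +ₘ-identityˡ Fin.zero ⟩
      Fin.zero               ∎)) ,
    (λ x Cx → from (zeroSum⇔ (⊖ x)) (trans (sumV-⊖ x) (trans (cong -ₘ_ (to (zeroSum⇔ x) Cx)) ε⁻¹≈ε)))
    where open ≡-Reasoning

  sumV-update : ∀ {n} (u : V n) i y → sumV (u [ i ]≔ y) +ₘ lookup u i ≡ sumV u +ₘ y
  sumV-update (x ∷ u) Fin.zero y = xy+z≡zy+x y (sumV u) x
  sumV-update (x ∷ u) (Fin.suc i) y = begin
    (x +ₘ sumV (u [ i ]≔ y)) +ₘ lookup u i ≡⟨ +ₘ-assoc x _ _ ⟩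
    x +ₘ (sumV (u [ i ]≔ y) +ₘ lookup u i) ≡⟨ cong (x +ₘ_) (sumV-update u i y) ⟩
    x +ₘ (sumV u +ₘ y)                     ≡⟨ +ₘ-assoc x _ _ ⟨
    (x +ₘ sumV u) +ₘ y                     ∎
    where open ≡-Reasoning

  balance : ∀ {n} → V n → Fin n → V n
  balance u i = u [ i ]≔ (lookup u i +ₘ (-ₘ sumV u))

  sumV-balance : ∀ {n} (u : V n) i → sumV (balance u i) ≡ Fin.zero
  sumV-balance u i = ∙-cancelʳ (lookup u i) _ _ (begin
    sumV (balance u i) +ₘ lookup u i         ≡⟨ sumV-update u i _ ⟩
    sumV u +ₘ (lookup u i +ₘ (-ₘ sumV u))    ≡⟨ +ₘ-assoc (sumV u) _ _ ⟨
    sumV u +ₘ lookup u i +ₘ (-ₘ sumV u)      ≡⟨ xyx⁻¹≈y (sumV u) (lookup u i) ⟩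
    lookup u i                               ≡⟨ +ₘ-identityˡ (lookup u i) ⟨
    Fin.zero +ₘ lookup u i                   ∎)
    where open ≡-Reasoning

  balance-moves : ∀ {n} (u : V n) i → sumV u ≢ Fin.zero → lookup (balance u i) i ≢ lookup u i
  balance-moves u i s≢0 moved≡ = s≢0 (begin
    sumV u                 ≡⟨ ⁻¹-involutive (sumV u) ⟨
    -ₘ (-ₘ sumV u)         ≡⟨ cong -ₘ_ -s≡0 ⟩
    -ₘ Fin.zero            ≡⟨ ε⁻¹≈ε ⟩
    Fin.zero               ∎)
    where
    open ≡-Reasoning
    -s≡0 : -ₘ sumV u ≡ Fin.zero
    -s≡0 = ∙-cancelˡ (lookup u i) _ _ (begin
      lookup u i +ₘ (-ₘ sumV u) ≡⟨ lookup∘update i u _ ⟨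
      lookup (balance u i) i    ≡⟨ moved≡ ⟩
      lookup u i                ≡⟨ identityʳ (lookup u i) ⟨
      lookup u i +ₘ Fin.zero    ∎)

  balance-keeps : ∀ {n} (u : V n) {i j} → j ≢ i → lookup (balance u i) j ≡ lookup u j
  balance-keeps u j≢i = lookup∘update′ j≢i u _

  adjacent⇒sumV≢ : ∀ {n} (u v : V n) → dist u v ≡ 1 → sumV u ≢ sumV v
  adjacent⇒sumV≢ [] [] () _
  adjacent⇒sumV≢ (a ∷ u) (b ∷ v) d same with a Fin.≟ b
  ... | yes refl = adjacent⇒sumV≢ u v d (∙-cancelˡ a _ _ same)
  ... | no a≢b = a≢b (∙-cancelʳ (sumV u) a b (trans same (cong (λ w → b +ₘ sumV w) (sym u≡v))))
    where
    u≡v : u ≡ v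
    u≡v = dist≡0⇒≡ u v (suc-injective d)

  near-sumV⇒≡ : ∀ {n} (u c : V n) → T (near u c) → sumV u ≡ sumV c → c ≡ u
  near-sumV⇒≡ u c near-u-c same with near⇒∈N u c near-u-c
  ... | inj₁ c≡u = c≡u
  ... | inj₂ adjacent = ⊥-elim (adjacent⇒sumV≢ u c adjacent same)

  balance∈J : ∀ {n} (v : V n) i → balance v i ∈J[ zeroSum , v ]
  balance∈J v i = near⇒∈N v _ (≤⇒≤ᵇ (dist-update≤1 v i _)) ,
                  from (zeroSum⇔ (balance v i)) (sumV-balance v i)

  Separates : ∀ {n} → V n → V n → V n → Set
  Separates c u v = c ∈J[ zeroSum , u ] × ¬ T (near v c)

  codeword-separated : ∀ {n} (u v : V n) {k₀ i} → lookup u k₀ ≢ lookup v k₀ → i ≢ k₀ →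
                       sumV u ≡ Fin.zero → Separates (balance v i) v u
  codeword-separated u v {k₀} {i} uk₀≢vk₀ i≢k₀ su≡0 = balance∈J v i , λ near-u-c →
    uk₀≢vk₀ (begin
      lookup u k₀ ≡⟨ cong (λ w → lookup w k₀) (near-sumV⇒≡ u c near-u-c same-sum) ⟨
      lookup c k₀ ≡⟨ balance-keeps v (i≢k₀ ∘ sym) ⟩
      lookup v k₀ ∎)
    where
    open ≡-Reasoning
    c = balance v i
    same-sum : sumV u ≡ sumV c
    same-sum = trans su≡0 (sym (sumV-balance v i))

  -- if balancing u at i lands in N[v], then balancing at i′ cannot
  noncodeword-separated : ∀ {n} (u v : V n) {k₀ i i′} → lookup u k₀ ≢ lookup v k₀ →
                          i ≢ k₀ → i′ ≢ k₀ → i ≢ i′ → sumV u ≢ Fin.zero →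
                          ∃[ c ] Separates c u v
  noncodeword-separated u v {k₀} {i} {i′} uk₀≢vk₀ i≢k₀ i′≢k₀ i≢i′ su≢0
    with T? (near v (balance u i))
  ... | no ¬near-v-c = balance u i , balance∈J u i , ¬near-v-c
  ... | yes near-v-c with lookup v i Fin.≟ lookup (balance u i) i
  ...   | no vi≢ci = ⊥-elim (differ₂⇒¬near v (balance u i) i≢k₀ vi≢ci
      (λ vk₀≡ck₀ → uk₀≢vk₀ (sym (trans vk₀≡ck₀ (balance-keeps u (i≢k₀ ∘ sym))))) near-v-c)
  ...   | yes vi≡ci = balance u i′ , balance∈J u i′ ,
          differ₂⇒¬near v (balance u i′) i≢k₀
            (λ vi≡c′i → balance-moves u i su≢0 (trans (sym vi≡ci) (trans vi≡c′i (balance-keeps u i≢i′))))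
            (λ vk₀≡c′k₀ → uk₀≢vk₀ (sym (trans vk₀≡c′k₀ (balance-keeps u (i′≢k₀ ∘ sym)))))

  two-others : ∀ {n} (k₀ : Fin (3 + n)) → ∃[ i ] ∃[ i′ ] i ≢ k₀ × i′ ≢ k₀ × i ≢ i′
  two-others Fin.zero = Fin.suc Fin.zero , Fin.suc (Fin.suc Fin.zero) , (λ ()) , (λ ()) , (λ ())
  two-others (Fin.suc Fin.zero) = Fin.zero , Fin.suc (Fin.suc Fin.zero) , (λ ()) , (λ ()) , (λ ())
  two-others (Fin.suc (Fin.suc k₀)) = Fin.zero , Fin.suc Fin.zero , (λ ()) , (λ ()) , (λ ())

  separated : ∀ {n} (u v : V (3 + n)) → u ≢ v → ∃[ c ] (Separates c u v ⊎ Separates c v u)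
  separated u v u≢v with ≢⇒differ u v u≢v
  ... | k₀ , uk₀≢vk₀ with two-others k₀ | sumV u Fin.≟ Fin.zero
  ...   | i , _ , i≢k₀ , _ , _ | yes su≡0 =
          balance v i , inj₂ (codeword-separated u v uk₀≢vk₀ i≢k₀ su≡0)
  ...   | i , i′ , i≢k₀ , i′≢k₀ , i≢i′ | no su≢0 =
          map₂ inj₁ (noncodeword-separated u v uk₀≢vk₀ i≢k₀ i′≢k₀ i≢i′ su≢0)

  zeroSum-isIdentifying : ∀ n → IsIdentifyingCode (zeroSum {3 + n})
  zeroSum-isIdentifying n = (λ v → balance v Fin.zero , balance∈J v Fin.zero) , distinct
    where
    distinct : ∀ (u v : V (3 + n)) → u ≢ v → ¬ (∀ c → c ∈J[ zeroSum , u ] ⇔ c ∈J[ zeroSum , v ])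
    distinct u v u≢v same with separated u v u≢v
    ... | c , inj₁ (c∈Ju , c∉Nv) = c∉Nv (∈N⇒near v c (proj₁ (to (same c) c∈Ju)))
    ... | c , inj₂ (c∈Jv , c∉Nu) = c∉Nu (∈N⇒near u c (proj₁ (from (same c) c∈Jv)))

  count-zeroSum : ∀ n → count (allV (suc n)) zeroSum ≡ m ^ n
  count-zeroSum n = begin
    count (allV (suc n)) zeroSum
      ≡⟨ ∑-allV-suc n _ ⟩
    ∑ (allFin m) (λ x → count (allV n) (λ v → zeroSum (x ∷ v)))
      ≡⟨ ∑-comm (allFin m) (allV n) (λ x v → ⟦ zeroSum (x ∷ v) ⟧) ⟩
    ∑ (allV n) (λ v → count (allFin m) (λ x → zeroSum (x ∷ v)))
      ≡⟨ ∑-cong (allV n) (λ v → trans (∑-cong (allFin m) (λ x → cong ⟦_⟧ (zeroSum-∷ x v)))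
                                       (count-allFin-≡ m (-ₘ sumV v))) ⟩
    ∑ (allV n) (λ _ → 1)
      ≡⟨ ∑-allV-one n ⟩
    m ^ n ∎
    where
    open ≡-Reasoning
    zeroSum-∷ : ∀ x v → zeroSum (x ∷ v) ≡ does (x Fin.≟ -ₘ sumV v)
    zeroSum-∷ x v = does-⇔ (x +ₘ sumV v Fin.≟ Fin.zero) (x Fin.≟ -ₘ sumV v)
      (mk⇔ (inverseˡ-unique x (sumV v)) (λ x≡-s → trans (cong (_+ₘ sumV v) x≡-s) (inverseˡ (sumV v))))

theorem3p10 : ∀ (m n : ℕ) → 3 ≤ n → 3 ≤ m →
    (Σ (Code m n) (λ C → IsGroupIdentifyingCode C × card C ≤ m ^ (n ∸ 1)))
    × (∀ (C : Code m n) → IsGroupIdentifyingCode C →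
         3 * m ^ n ≤ card C * (n * (m ∸ 1) + 3))
-- The hypothesis 3 ≤ m only excludes m = 0: neither bound needs m ≥ 3.
theorem3p10 zero _ _ ()
theorem3p10 (suc k) 1 (s≤s ()) _
theorem3p10 (suc k) 2 (s≤s (s≤s ())) _
theorem3p10 (suc k) n@(suc (suc (suc n′))) _ _ =
  (zeroSum , (zeroSum-isSubgroup n , zeroSum-isIdentifying n′) ,
     ≤-reflexive (trans (length-filter≡count (allV n) zeroSum) (count-zeroSum (2 + n′)))) ,
  λ C (subgroup , identifying) →
    subst (λ size → 3 * suc k ^ n ≤ size * (n * k + 3)) (sym (length-filter≡count (allV n) C))
          (LowerBound.lower-bound k n C subgroup identifying)
  where
  open Counting
  open HammingGraph k
  open UpperBound k
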